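{- Let $m\ge1$ and let $a$ be an integer with $2^{m-1}+1\leq a\leq 2^m$. Then $$B_a=\bigl(C_{2^m}\cap E_a(B_{2^m-a})\bigr)\cup\bigl(B_{2^m}\cap E_a(C_{2^m-a})\bigr),\qquad C_a=\bigl(B_{2^m}\cap E_a(B_{2^m-a})\bigr)\cup\bigl(C_{2^m}\cap E_a(C_{2^m-a})\bigr).$$
   Context: $\mathbb{N}_0=\{0,1,2,\dots\}$. $t(n)$ is the Thue–Morse sequence: $t(n)=0$ if the binary expansion of $n$ has an even number of $1$'s, $t(n)=1$ otherwise. For integers $a\ge0$, $B_a=\{x\in\mathbb{N}_0: t(x+a)=1-t(x)\}$ and $C_a=\{x\in\mathbb{N}_0: t(x+a)=t(x)\}$ (so $B_0=\emptyset$, $C_0=\mathbb{N}_0$). For a set of integers $A$ and $h\in\mathbb{Z}$, $E_h(A)=\{y-h: y\in A\}$. -}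

module Defs where

open import Data.Nat using (ℕ; zero; suc; _+_; _∸_; _≡ᵇ_)
open import Data.Nat.DivMod using (_/_; _%_)
open import Data.Bool using (Bool; true; false; if_then_else_)
open import Relation.Binary.PropositionalEquality using (_≡_)
open import Relation.Unary using (Pred)
open import Level using (0ℓ)

-- Thue–Morse with fuel: tmFuel f n = parity of the number of 1's among the
-- lowest f binary digits of n.  Fuel n suffices, since n has at most n digits.
tmFuel : ℕ → ℕ → ℕ
tmFuel zero    n = 0
tmFuel (suc f) n = if (n % 2 ≡ᵇ 1) then 1 ∸ tmFuel f (n / 2) else tmFuel f (n / 2)

t : ℕ → ℕ
t n = tmFuel n n

B : ℕ → Pred ℕ 0ℓ
B a x = t (x + a) ≡ 1 ∸ t x

C : ℕ → Pred ℕ 0ℓ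
C a x = t (x + a) ≡ t x

-- E_h(A) = {y - h : y ∈ A}, restricted to ℕ₀ (all sets it is intersected
-- with are subsets of ℕ₀): x ∈ E_h(A) iff x + h ∈ A.
E : ℕ → Pred ℕ 0ℓ → Pred ℕ 0ℓ
E h A x = A (x + h)

module Submission where

-- The identities are a pure parity argument and hold for any
-- shifts a ≤ b; the theorem is the case b = 2^m, and its lower bound on a
-- is not needed.  Fix x and write p = t x, q = t (x+a), r = t (x+b).  Because
-- x + a + (b - a) = x + b, membership of x in E_a(B_{b-a}) resp.
-- E_a(C_{b-a}) says r = 1 - q resp. r = q, while x ∈ C_b resp. B_b says
-- r = p resp. r = 1 - p.  Since p, q, r ∈ {0,1} and 1 - (1 - p) = p on
-- bits, "q differs from p" holds exactly when r agrees with one of p, q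
-- and differs from the other, and "q equals p" exactly when r agrees with
-- both or differs from both.

open import Defs
open import Data.Nat using (ℕ; zero; suc; _≤_; _∸_; _^_; _+_; _≡ᵇ_)
open import Data.Nat.DivMod using (_/_; _%_)
open import Data.Nat.Properties using (+-assoc; m+[n∸m]≡n)
open import Data.Bool using (true; false)
open import Data.Product using (_×_; _,_)
open import Data.Sum using (_⊎_; inj₁; inj₂)
open import Function.Bundles using (_⇔_; mk⇔; Equivalence)
open import Relation.Binary.PropositionalEquality
open import Relation.Unary using (_∩_; _∪_; _≐_)

data Bit : ℕ → Set where
  b0 : Bit 0
  b1 : Bit 1

flip : ∀ {p} → Bit p → Bit (1 ∸ p)
flip b0 = b1
flip b1 = b0

flip-involutive : ∀ {p} → Bit p → 1 ∸ (1 ∸ p) ≡ p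
flip-involutive b0 = refl
flip-involutive b1 = refl

bit-dichotomy : ∀ {p r} → Bit p → Bit r → r ≡ p ⊎ r ≡ 1 ∸ p
bit-dichotomy b0 b0 = inj₁ refl
bit-dichotomy b0 b1 = inj₂ refl
bit-dichotomy b1 b0 = inj₂ refl
bit-dichotomy b1 b1 = inj₁ refl

tmFuel-bit : ∀ f n → Bit (tmFuel f n)
tmFuel-bit zero    n = b0
tmFuel-bit (suc f) n with n % 2 ≡ᵇ 1
... | true  = flip (tmFuel-bit f (n / 2))
... | false = tmFuel-bit f (n / 2)

t-bit : ∀ n → Bit (t n)
t-bit n = tmFuel-bit n n

-- The two decompositions, with p = t x, q = t (x+a), r = t (x+b), and
-- s = t (x+a+(b-a)) standing for the value at the shifted point (which
-- equals r, but only propositionally).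
FlipSplit : ℕ → ℕ → ℕ → ℕ → Set
FlipSplit p q r s = (r ≡ p × s ≡ 1 ∸ q) ⊎ (r ≡ 1 ∸ p × s ≡ q)

SameSplit : ℕ → ℕ → ℕ → ℕ → Set
SameSplit p q r s = (r ≡ 1 ∸ p × s ≡ 1 ∸ q) ⊎ (r ≡ p × s ≡ q)

flip-split : ∀ {p q r} → Bit p → Bit q → Bit r →
             (q ≡ 1 ∸ p) ⇔ FlipSplit p q r r
flip-split {p} {q} {r} bp bq br = mk⇔ split join
  where
  split : q ≡ 1 ∸ p → FlipSplit p q r r
  split q≡p′ with bit-dichotomy bp br
  ... | inj₁ r≡p  = inj₁ (r≡p , (begin
          r           ≡⟨ r≡p ⟩
          p           ≡⟨ flip-involutive bp ⟨
          1 ∸ (1 ∸ p) ≡⟨ cong (1 ∸_) q≡p′ ⟨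
          1 ∸ q       ∎))
    where open ≡-Reasoning
  ... | inj₂ r≡p′ = inj₂ (r≡p′ , trans r≡p′ (sym q≡p′))

  join : FlipSplit p q r r → q ≡ 1 ∸ p
  join (inj₁ (r≡p , r≡q′)) = begin
    q           ≡⟨ flip-involutive bq ⟨
    1 ∸ (1 ∸ q) ≡⟨ cong (1 ∸_) r≡q′ ⟨
    1 ∸ r       ≡⟨ cong (1 ∸_) r≡p ⟩
    1 ∸ p       ∎
    where open ≡-Reasoning
  join (inj₂ (r≡p′ , r≡q)) = trans (sym r≡q) r≡p′

same-split : ∀ {p q r} → Bit p → Bit q → Bit r →
             (q ≡ p) ⇔ SameSplit p q r r
same-split {p} {q} {r} bp bq br = mk⇔ split join
  where
  split : q ≡ p → SameSplit p q r r
  split q≡p with bit-dichotomy bp br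
  ... | inj₁ r≡p  = inj₂ (r≡p , trans r≡p (sym q≡p))
  ... | inj₂ r≡p′ = inj₁ (r≡p′ , trans r≡p′ (cong (1 ∸_) (sym q≡p)))

  join : SameSplit p q r r → q ≡ p
  join (inj₁ (r≡p′ , r≡q′)) = begin
    q           ≡⟨ flip-involutive bq ⟨
    1 ∸ (1 ∸ q) ≡⟨ cong (1 ∸_) r≡q′ ⟨
    1 ∸ r       ≡⟨ cong (1 ∸_) r≡p′ ⟩
    1 ∸ (1 ∸ p) ≡⟨ flip-involutive bp ⟩
    p           ∎
    where open ≡-Reasoning
  join (inj₂ (r≡p , r≡q)) = trans (sym r≡q) r≡p

shift-compose : ∀ {a b} → a ≤ b → ∀ x → t (x + a + (b ∸ a)) ≡ t (x + b)
shift-compose {a} a≤b x =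
  cong t (trans (+-assoc x a _) (cong (x +_) (m+[n∸m]≡n a≤b)))

B-decomposition : ∀ {a b} → a ≤ b →
  B a ≐ ((C b ∩ E a (B (b ∸ a))) ∪ (B b ∩ E a (C (b ∸ a))))
B-decomposition {a} {b} a≤b =
    (λ {x} x∈B → subst (FlipSplit _ _ _) (sym (shift-compose a≤b x))
                       (Equivalence.to (split x) x∈B))
  , (λ {x} h → Equivalence.from (split x)
                 (subst (FlipSplit _ _ _) (shift-compose a≤b x) h))
  where
  split : ∀ x → B a x ⇔ FlipSplit (t x) (t (x + a)) (t (x + b)) (t (x + b))
  split x = flip-split (t-bit x) (t-bit (x + a)) (t-bit (x + b))

C-decomposition : ∀ {a b} → a ≤ b →
  C a ≐ ((B b ∩ E a (B (b ∸ a))) ∪ (C b ∩ E a (C (b ∸ a))))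
C-decomposition {a} {b} a≤b =
    (λ {x} x∈C → subst (SameSplit _ _ _) (sym (shift-compose a≤b x))
                       (Equivalence.to (split x) x∈C))
  , (λ {x} h → Equivalence.from (split x)
                 (subst (SameSplit _ _ _) (shift-compose a≤b x) h))
  where
  split : ∀ x → C a x ⇔ SameSplit (t x) (t (x + a)) (t (x + b)) (t (x + b))
  split x = same-split (t-bit x) (t-bit (x + a)) (t-bit (x + b))

theorem6 : (m a : ℕ) → 1 ≤ m → 2 ^ (m ∸ 1) + 1 ≤ a → a ≤ 2 ^ m →
    (B a ≐ ((C (2 ^ m) ∩ E a (B (2 ^ m ∸ a))) ∪ (B (2 ^ m) ∩ E a (C (2 ^ m ∸ a)))))
    × (C a ≐ ((B (2 ^ m) ∩ E a (B (2 ^ m ∸ a))) ∪ (C (2 ^ m) ∩ E a (C (2 ^ m ∸ a)))))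
theorem6 m a _ _ a≤2^m = B-decomposition a≤2^m , C-decomposition a≤2^m
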